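{- Consider $\mathrm{Sublime}_{\mathrm{MG}}$ with an increasing size function $W(\cdot)$ on an insertion-only stream, with time divided into epochs as in the context. Let $E(N)=\max_x(f(x)-\hat f(x))$ denote its estimation error when the stream has $N$ keys. Then at the end of epoch $i$, $$E(N_i)\le\sum_{j=0}^{i}\frac{N_j-N_{j-1}}{W(N_j)+1},$$ where $N_j$ ($j\ge0$) is the total number of keys in the stream at the end of epoch $j$ and $N_{ -1}=0$.
   Context: Misra-Gries with $w$ slots: each slot stores a key and a counter; on insertion of $x$: if $x$ is stored, increment its counter; else if an empty slot exists, store $(x,1)$; else decrement all counters by one and discard keys whose counters become $0$ ($x$ not stored). $\hat f(x)$ is $x$'s counter if stored, else $0$; $f(x)$ is the true count and $N=\sum_x f(x)$. $\mathrm{Sublime}_{\mathrm{MG}}$ increases its number of slots according to the size function $W$. Epochs: for a sequence $N_0<N_1<N_2<\cdots$ with $W(N_0)<W(N_1)<\cdots$, the sketch uses $W(N_0)$ slots until the stream length reaches $N_0$ (epoch 0), and during epoch $j\ge1$ (stream length from $N_{j-1}$ to $N_j$) it uses $W(N_j)$ slots, new slots being added empty. -}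

module Defs where

open import Data.Nat using (ℕ; zero; suc; _+_; _∸_; _<_; _≤_; _<ᵇ_)
open import Data.Bool using (Bool; true; false; if_then_else_)
open import Data.List using (List; []; _∷_; length; _++_)
open import Data.Product using (_×_; _,_)
open import Data.Integer using (+_)
open import Data.Rational as ℚ using (ℚ; _/_)
open import Relation.Nullary using (yes; no)
open import Relation.Binary.Definitions using (DecidableEquality)

-- Misra-Gries state: list of occupied slots (key , counter).
-- Unused slots are simply absent, so enlarging the number of slots
-- adds empty slots.  Invariant (maintained by mgInsert): counters ≥ 1.
MGState : Set → Set
MGState K = List (K × ℕ)

module _ {K : Set} (_≟_ : DecidableEquality K) where

  stored : K → MGState K → Bool
  stored x []             = false
  stored x ((k , c) ∷ st) with x ≟ k
  ... | yes _ = true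
  ... | no  _ = stored x st

  increment : K → MGState K → MGState K
  increment x []             = []
  increment x ((k , c) ∷ st) with x ≟ k
  ... | yes _ = (k , suc c) ∷ st
  ... | no  _ = (k , c) ∷ increment x st

  decrementAll : MGState K → MGState K
  decrementAll []                   = []
  decrementAll ((k , zero)  ∷ st)   = decrementAll st
  decrementAll ((k , suc zero) ∷ st) = decrementAll st
  decrementAll ((k , suc (suc c)) ∷ st) = (k , suc c) ∷ decrementAll st

  mgInsert : ℕ → K → MGState K → MGState K
  mgInsert w x st =
    if stored x st then increment x st
    else (if length st <ᵇ w then st ++ ((x , 1) ∷ [])
          else decrementAll st)

  estimate : K → MGState K → ℕ
  estimate x []             = 0
  estimate x ((k , c) ∷ st) with x ≟ k
  ... | yes _ = c
  ... | no  _ = estimate x st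

  freq : (ℕ → K) → ℕ → K → ℕ
  freq s zero    x = 0
  freq s (suc n) x with s n ≟ x
  ... | yes _ = suc (freq s n x)
  ... | no  _ = freq s n x

  processRange : ℕ → (ℕ → K) → ℕ → ℕ → MGState K → MGState K
  processRange w s from zero      st = st
  processRange w s from (suc len) st =
    processRange w s (suc from) len (mgInsert w (s from) st)

  sublimeMG : (W : ℕ → ℕ) (N : ℕ → ℕ) (s : ℕ → K) → ℕ → MGState K
  sublimeMG W N s zero    = processRange (W (N 0)) s 0 (N 0) []
  sublimeMG W N s (suc j) =
    processRange (W (N (suc j))) s (N j) (N (suc j) ∸ N j) (sublimeMG W N s j)

errorBound : (W : ℕ → ℕ) (N : ℕ → ℕ) → ℕ → ℚ
errorBound W N zero    = (+ N 0) / suc (W (N 0))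
errorBound W N (suc j) =
  errorBound W N j ℚ.+ (+ (N (suc j) ∸ N j)) / suc (W (N (suc j)))

{-# OPTIONS --safe #-}
-- A decrement-all step with w slots happens only when at least w keys are stored and the
-- arrival is not, so relative to "previous mass + 1" it destroys at least w + 1 units of
-- counter mass, and it is the only kind of step in which f(x) - f̂(x) can grow (by at most
-- one). Hence, if epoch j performs D_j such steps, D_j (W(N_j) + 1) plus the mass left at
-- its end is at most the mass it started with plus N_j - N_{j-1}, and f(x) - f̂(x) is at
-- most Σ D_j. By induction on i the potential  Σ_{j≤i} D_j + mass_i / (W(N_i) + 1)  is
-- bounded by the claimed sum: the mass carried into epoch i + 1 is charged at rate
-- 1 / (W(N_{i+1}) + 1), which is no more than the rate 1 / (W(N_i) + 1) paid for it so far.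
module Submission where

open import Defs
open import Data.Nat using (ℕ; suc; _≤_; _<_)
open import Data.Integer using (+_)
open import Data.Rational using (ℚ; _/_; _-_)
open import Data.Rational as ℚ using ()
open import Relation.Binary.Definitions using (DecidableEquality)

open import Data.Bool using (true; false)
open import Data.Empty using (⊥-elim)
import Data.Integer as ℤ
import Data.Integer.Properties as ℤ
open import Data.List using ([]; _∷_; [_]; _++_; length; map)
open import Data.List.Properties using (map-++)
open import Data.List.Relation.Unary.All using (All; []; _∷_)
open import Data.List.Relation.Unary.All.Properties using (++⁺)
open import Data.Nat using (zero; _+_; _*_; _∸_; _<ᵇ_; z≤n; s≤s)
open import Data.Nat.ListAction using (sum)
open import Data.Nat.ListAction.Properties using (sum-++)
open import Data.Nat.Properties
open import Algebra.Properties.CommutativeSemigroup +-commutativeSemigroup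
  using (xy∙z≈y∙xz; x∙yz≈y∙xz)
open import Data.Product using (_,_; proj₂)
import Data.Rational.Properties as ℚ
open import Data.Rational.Unnormalised as ℚᵘ using (ℚᵘ; mkℚᵘ; *≤*; *≡*)
import Data.Rational.Unnormalised.Properties as ℚᵘ
open import Relation.Nullary using (yes; no; ofⁿ)
open import Relation.Binary.PropositionalEquality
  using (_≡_; _≢_; ≢-sym; refl; sym; trans; cong; cong₂; subst₂; module ≡-Reasoning)

infix 7 _/suc_

_/suc_ : ℕ → ℕ → ℚᵘ
n /suc d = mkℚᵘ (+ n) d

cross-≤ : ∀ {a b d e} → a * suc e ≤ b * suc d → a /suc d ℚᵘ.≤ b /suc e
cross-≤ {a} {b} {d} {e} h =
  *≤* (subst₂ ℤ._≤_ (ℤ.pos-* a (suc e)) (ℤ.pos-* b (suc d)) (ℤ.+≤+ h))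

cross-≃ : ∀ {a b d e} → a * suc e ≡ b * suc d → a /suc d ℚᵘ.≃ b /suc e
cross-≃ {a} {b} {d} {e} h =
  *≡* (subst₂ _≡_ (ℤ.pos-* a (suc e)) (ℤ.pos-* b (suc d)) (cong +_ h))

/suc-monoˡ-≤ : ∀ {a b} d → a ≤ b → a /suc d ℚᵘ.≤ b /suc d
/suc-monoˡ-≤ d a≤b = cross-≤ (*-monoˡ-≤ (suc d) a≤b)

/suc-antimonoʳ-≤ : ∀ a {d e} → d ≤ e → a /suc e ℚᵘ.≤ a /suc d
/suc-antimonoʳ-≤ a d≤e = cross-≤ (*-monoʳ-≤ a (s≤s d≤e))

/suc-distrib-+ : ∀ a b d → (a + b) /suc d ℚᵘ.≃ a /suc d ℚᵘ.+ b /suc d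
/suc-distrib-+ a b d = *≡* (begin
  + (a + b) ℤ.* + (suc d * suc d)
    ≡⟨ cong₂ ℤ._*_ (ℤ.pos-+ a b) (ℤ.pos-* (suc d) (suc d)) ⟩
  (+ a ℤ.+ + b) ℤ.* (+ suc d ℤ.* + suc d)
    ≡⟨ ℤ.*-assoc (+ a ℤ.+ + b) (+ suc d) (+ suc d) ⟨
  (+ a ℤ.+ + b) ℤ.* + suc d ℤ.* + suc d
    ≡⟨ cong (ℤ._* + suc d) (ℤ.*-distribʳ-+ (+ suc d) (+ a) (+ b)) ⟩
  (+ a ℤ.* + suc d ℤ.+ + b ℤ.* + suc d) ℤ.* + suc d ∎)
  where open ≡-Reasoning

mixed-fraction : ∀ a b d → (a * suc d + b) /suc d ℚᵘ.≃ a /suc 0 ℚᵘ.+ b /suc d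
mixed-fraction a b d = ℚᵘ.≃-trans (/suc-distrib-+ (a * suc d) b d)
  (ℚᵘ.+-congˡ (b /suc d) (cross-≃ {a * suc d} {a} {d} {0} (*-identityʳ (a * suc d))))

amortised-≤ : ∀ D m w {n} → D * suc w + m ≤ n → D /suc 0 ℚᵘ.+ m /suc w ℚᵘ.≤ n /suc w
amortised-≤ D m w h = ℚᵘ.≤-respˡ-≃ (mixed-fraction D m w) (/suc-monoˡ-≤ w h)

potential-step : ∀ {m m′ n w w′} {B : ℚᵘ} D D′ → w ≤ w′ →
                 D′ * suc w′ + m′ ≤ n + m →
                 D /suc 0 ℚᵘ.+ m /suc w ℚᵘ.≤ B →
                 (D + D′) /suc 0 ℚᵘ.+ m′ /suc w′ ℚᵘ.≤ B ℚᵘ.+ n /suc w′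
potential-step {m} {m′} {n} {w} {w′} {B} D D′ w≤w′ mass-bound potential = begin
  (D + D′) /suc 0 ℚᵘ.+ m′ /suc w′
    ≃⟨ ℚᵘ.+-congˡ (m′ /suc w′) (/suc-distrib-+ D D′ 0) ⟩
  (D /suc 0 ℚᵘ.+ D′ /suc 0) ℚᵘ.+ m′ /suc w′
    ≃⟨ ℚᵘ.+-assoc (D /suc 0) (D′ /suc 0) (m′ /suc w′) ⟩
  D /suc 0 ℚᵘ.+ (D′ /suc 0 ℚᵘ.+ m′ /suc w′)
    ≤⟨ ℚᵘ.+-monoʳ-≤ (D /suc 0) (amortised-≤ D′ m′ w′ mass-bound) ⟩
  D /suc 0 ℚᵘ.+ (n + m) /suc w′
    ≃⟨ ℚᵘ.+-congʳ (D /suc 0) (/suc-distrib-+ n m w′) ⟩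
  D /suc 0 ℚᵘ.+ (n /suc w′ ℚᵘ.+ m /suc w′)
    ≃⟨ ℚᵘ.+-congʳ (D /suc 0) (ℚᵘ.+-comm (n /suc w′) (m /suc w′)) ⟩
  D /suc 0 ℚᵘ.+ (m /suc w′ ℚᵘ.+ n /suc w′)
    ≃⟨ ℚᵘ.+-assoc (D /suc 0) (m /suc w′) (n /suc w′) ⟨
  (D /suc 0 ℚᵘ.+ m /suc w′) ℚᵘ.+ n /suc w′
    ≤⟨ ℚᵘ.+-monoˡ-≤ (n /suc w′) (ℚᵘ.+-monoʳ-≤ (D /suc 0) (/suc-antimonoʳ-≤ m w≤w′)) ⟩
  (D /suc 0 ℚᵘ.+ m /suc w) ℚᵘ.+ n /suc w′
    ≤⟨ ℚᵘ.+-monoˡ-≤ (n /suc w′) potential ⟩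
  B ℚᵘ.+ n /suc w′ ∎
  where open ℚᵘ.≤-Reasoning

p≤q+r⇒p-r≤q : ∀ {p q r} → p ℚᵘ.≤ q ℚᵘ.+ r → p ℚᵘ.- r ℚᵘ.≤ q
p≤q+r⇒p-r≤q {p} {q} {r} p≤q+r = begin
  p ℚᵘ.- r            ≤⟨ ℚᵘ.+-monoˡ-≤ (ℚᵘ.- r) p≤q+r ⟩
  (q ℚᵘ.+ r) ℚᵘ.- r   ≃⟨ ℚᵘ.+-assoc q r (ℚᵘ.- r) ⟩
  q ℚᵘ.+ (r ℚᵘ.- r)   ≃⟨ ℚᵘ.+-congʳ q (ℚᵘ.+-inverseʳ r) ⟩
  q ℚᵘ.+ ℚᵘ.0ℚᵘ       ≃⟨ ℚᵘ.+-identityʳ q ⟩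
  q                   ∎
  where open ℚᵘ.≤-Reasoning

toℚᵘ-/ : ∀ n d → ℚ.toℚᵘ ((+ n) / suc d) ℚᵘ.≃ n /suc d
toℚᵘ-/ n d = ℚ.toℚᵘ-fromℚᵘ (n /suc d)

toℚᵘ-errorBound-suc : ∀ W N j →
                      ℚ.toℚᵘ (errorBound W N (suc j)) ℚᵘ.≃
                      ℚ.toℚᵘ (errorBound W N j) ℚᵘ.+ (N (suc j) ∸ N j) /suc W (N (suc j))
toℚᵘ-errorBound-suc W N j =
  ℚᵘ.≃-trans (ℚ.toℚᵘ-homo-+ (errorBound W N j) _)
             (ℚᵘ.+-congʳ (ℚ.toℚᵘ (errorBound W N j)) (toℚᵘ-/ _ _))

difference-≤ : ∀ {F E D} {B : ℚ} → F ≤ D + E → D /suc 0 ℚᵘ.≤ ℚ.toℚᵘ B →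
               (+ F) / 1 - (+ E) / 1 ℚ.≤ B
difference-≤ {F} {E} {D} {B} F≤D+E D≤B = ℚ.toℚᵘ-cancel-≤ (begin
  ℚ.toℚᵘ ((+ F) / 1 - (+ E) / 1)
    ≃⟨ ℚ.toℚᵘ-homo-+ ((+ F) / 1) (ℚ.- ((+ E) / 1)) ⟩
  ℚ.toℚᵘ ((+ F) / 1) ℚᵘ.+ ℚ.toℚᵘ (ℚ.- ((+ E) / 1))
    ≃⟨ ℚᵘ.+-cong (toℚᵘ-/ F 0) (ℚᵘ.≃-trans (ℚ.toℚᵘ-homo‿- ((+ E) / 1)) (ℚᵘ.-‿cong (toℚᵘ-/ E 0))) ⟩
  F /suc 0 ℚᵘ.- E /suc 0
    ≤⟨ p≤q+r⇒p-r≤q {r = E /suc 0} F≤D+E/1 ⟩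
  D /suc 0
    ≤⟨ D≤B ⟩
  ℚ.toℚᵘ B ∎)
  where
  open ℚᵘ.≤-Reasoning
  F≤D+E/1 : F /suc 0 ℚᵘ.≤ D /suc 0 ℚᵘ.+ E /suc 0
  F≤D+E/1 = ℚᵘ.≤-respʳ-≃ (/suc-distrib-+ D E 0) (/suc-monoˡ-≤ 0 F≤D+E)

≤-telescope : ∀ x₁ x₂ y₁ y₂ {s₀ s₁ s₂} →
              x₁ + s₀ ≤ y₁ + s₁ → x₂ + s₁ ≤ y₂ + s₂ → (x₁ + x₂) + s₀ ≤ (y₁ + y₂) + s₂
≤-telescope x₁ x₂ y₁ y₂ {s₀} {s₁} {s₂} step₁ step₂ = begin
  (x₁ + x₂) + s₀   ≡⟨ xy∙z≈y∙xz x₁ x₂ s₀ ⟩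
  x₂ + (x₁ + s₀)   ≤⟨ +-monoʳ-≤ x₂ step₁ ⟩
  x₂ + (y₁ + s₁)   ≡⟨ x∙yz≈y∙xz x₂ y₁ s₁ ⟩
  y₁ + (x₂ + s₁)   ≤⟨ +-monoʳ-≤ y₁ step₂ ⟩
  y₁ + (y₂ + s₂)   ≡⟨ +-assoc y₁ y₂ s₂ ⟨
  (y₁ + y₂) + s₂   ∎
  where open ≤-Reasoning

module MisraGries {K : Set} (_≟_ : DecidableEquality K) where

  mass : MGState K → ℕ
  mass st = sum (map proj₂ st)

  Positive : MGState K → Set
  Positive = All (λ slot → 1 ≤ proj₂ slot)

  hit : K → K → ℕ
  hit y x with y ≟ x
  ... | yes _ = 1
  ... | no  _ = 0

  hits : (ℕ → K) → ℕ → ℕ → K → ℕ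
  hits s from zero      x = 0
  hits s from (suc len) x = hit (s from) x + hits s (suc from) len x

  freq-suc : ∀ s n x → freq _≟_ s (suc n) x ≡ hit (s n) x + freq _≟_ s n x
  freq-suc s n x with s n ≟ x
  ... | yes _ = refl
  ... | no  _ = refl

  freq-+ : ∀ s from len x →
           freq _≟_ s (from + len) x ≡ freq _≟_ s from x + hits s from len x
  freq-+ s from zero x =
    trans (cong (λ n → freq _≟_ s n x) (+-identityʳ from)) (sym (+-identityʳ _))
  freq-+ s from (suc len) x = begin
    freq _≟_ s (from + suc len) x
      ≡⟨ cong (λ n → freq _≟_ s n x) (+-suc from len) ⟩
    freq _≟_ s (suc from + len) x
      ≡⟨ freq-+ s (suc from) len x ⟩
    freq _≟_ s (suc from) x + hits s (suc from) len x
      ≡⟨ cong (_+ hits s (suc from) len x) (freq-suc s from x) ⟩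
    (hit (s from) x + freq _≟_ s from x) + hits s (suc from) len x
      ≡⟨ xy∙z≈y∙xz (hit (s from) x) _ _ ⟩
    freq _≟_ s from x + (hit (s from) x + hits s (suc from) len x) ∎
    where open ≡-Reasoning

  estimate-unstored : ∀ y st → stored _≟_ y st ≡ false → estimate _≟_ y st ≡ 0
  estimate-unstored y []             _ = refl
  estimate-unstored y ((k , c) ∷ st) unstored with y ≟ k
  estimate-unstored y ((k , c) ∷ st) ()       | yes _
  estimate-unstored y ((k , c) ∷ st) unstored | no  _ = estimate-unstored y st unstored

  estimate-increment-self : ∀ y st → stored _≟_ y st ≡ true →
                            estimate _≟_ y (increment _≟_ y st) ≡ suc (estimate _≟_ y st)
  estimate-increment-self y ((k , c) ∷ st) isStored with y ≟ k
  ... | yes y≡k with y ≟ k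
  ...   | yes _   = refl
  ...   | no  y≢k = ⊥-elim (y≢k y≡k)
  estimate-increment-self y ((k , c) ∷ st) isStored | no y≢k with y ≟ k
  ...   | yes y≡k = ⊥-elim (y≢k y≡k)
  ...   | no  _   = estimate-increment-self y st isStored

  estimate-increment-other : ∀ x y st → x ≢ y →
                             estimate _≟_ x (increment _≟_ y st) ≡ estimate _≟_ x st
  estimate-increment-other x y []             x≢y = refl
  estimate-increment-other x y ((k , c) ∷ st) x≢y with y ≟ k
  ... | yes refl with x ≟ y
  ...   | yes x≡y = ⊥-elim (x≢y x≡y)
  ...   | no  _   = refl
  estimate-increment-other x y ((k , c) ∷ st) x≢y | no _ with x ≟ k
  ...   | yes _ = refl
  ...   | no  _ = estimate-increment-other x y st x≢y

  estimate-++ : ∀ x st slots → estimate _≟_ x st ≤ estimate _≟_ x (st ++ slots)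
  estimate-++ x []             slots = z≤n
  estimate-++ x ((k , c) ∷ st) slots with x ≟ k
  ... | yes _ = ≤-refl
  ... | no  _ = estimate-++ x st slots

  estimate-append-unstored : ∀ y st → stored _≟_ y st ≡ false →
                             estimate _≟_ y (st ++ [ (y , 1) ]) ≡ 1
  estimate-append-unstored y [] _ with y ≟ y
  ... | yes _   = refl
  ... | no  y≢y = ⊥-elim (y≢y refl)
  estimate-append-unstored y ((k , c) ∷ st) unstored with y ≟ k
  estimate-append-unstored y ((k , c) ∷ st) ()       | yes _
  estimate-append-unstored y ((k , c) ∷ st) unstored | no  _ =
    estimate-append-unstored y st unstored

  estimate-decrementAll : ∀ x st →
                          estimate _≟_ x st ≤ suc (estimate _≟_ x (decrementAll _≟_ st))
  estimate-decrementAll x [] = z≤n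
  estimate-decrementAll x ((k , zero) ∷ st) with x ≟ k
  ... | yes _ = z≤n
  ... | no  _ = estimate-decrementAll x st
  estimate-decrementAll x ((k , suc zero) ∷ st) with x ≟ k
  ... | yes _ = s≤s z≤n
  ... | no  _ = estimate-decrementAll x st
  estimate-decrementAll x ((k , suc (suc c)) ∷ st) with x ≟ k
  ... | yes _ = ≤-refl
  ... | no  _ = estimate-decrementAll x st

  mass-increment : ∀ y st → mass (increment _≟_ y st) ≤ suc (mass st)
  mass-increment y [] = z≤n
  mass-increment y ((k , c) ∷ st) with y ≟ k
  ... | yes _ = ≤-refl
  ... | no  _ = ≤-trans (+-monoʳ-≤ c (mass-increment y st)) (≤-reflexive (+-suc c (mass st)))

  mass-++ : ∀ st slots → mass (st ++ slots) ≡ mass st + mass slots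
  mass-++ st slots =
    trans (cong sum (map-++ proj₂ st slots)) (sum-++ (map proj₂ st) (map proj₂ slots))

  length+mass-decrementAll : ∀ st → Positive st →
                             length st + mass (decrementAll _≟_ st) ≡ mass st
  length+mass-decrementAll [] [] = refl
  length+mass-decrementAll ((k , suc zero) ∷ st) (_ ∷ pos) =
    cong suc (length+mass-decrementAll st pos)
  length+mass-decrementAll ((k , suc (suc c)) ∷ st) (_ ∷ pos) = cong suc (begin
    length st + (suc c + mass (decrementAll _≟_ st))
      ≡⟨ x∙yz≈y∙xz (length st) (suc c) _ ⟩
    suc c + (length st + mass (decrementAll _≟_ st))
      ≡⟨ cong (_+_ (suc c)) (length+mass-decrementAll st pos) ⟩
    suc c + mass st ∎)
    where open ≡-Reasoning

  increment-positive : ∀ y st → Positive st → Positive (increment _≟_ y st)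
  increment-positive y []             []          = []
  increment-positive y ((k , c) ∷ st) (c≥1 ∷ pos) with y ≟ k
  ... | yes _ = s≤s z≤n ∷ pos
  ... | no  _ = c≥1 ∷ increment-positive y st pos

  decrementAll-positive : ∀ st → Positive (decrementAll _≟_ st)
  decrementAll-positive []                       = []
  decrementAll-positive ((k , zero) ∷ st)        = decrementAll-positive st
  decrementAll-positive ((k , suc zero) ∷ st)    = decrementAll-positive st
  decrementAll-positive ((k , suc (suc c)) ∷ st) = s≤s z≤n ∷ decrementAll-positive st

  record Summary (x : K) (w arrivals hits : ℕ) (st st′ : MGState K) : Set where
    field
      decrements     : ℕ
      mass-bound     : decrements * suc w + mass st′ ≤ arrivals + mass st
      estimate-bound : hits + estimate _≟_ x st ≤ decrements + estimate _≟_ x st′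
      positive       : Positive st′

  module _ {x : K} {w : ℕ} where

    empty-summary : ∀ {st} → Positive st → Summary x w 0 0 st st
    empty-summary pos = record
      { decrements = 0 ; mass-bound = ≤-refl ; estimate-bound = ≤-refl ; positive = pos }

    _⨾_ : ∀ {a₁ a₂ h₁ h₂ st₀ st₁ st₂} →
          Summary x w a₁ h₁ st₀ st₁ → Summary x w a₂ h₂ st₁ st₂ →
          Summary x w (a₁ + a₂) (h₁ + h₂) st₀ st₂
    _⨾_ {a₁} {a₂} {h₁} {h₂} {st₀ = st₀} {st₂ = st₂} first second = record
      { decrements     = d₁ + d₂
      ; mass-bound     = mass-bound
      ; estimate-bound = ≤-telescope h₁ h₂ d₁ d₂
                           (Summary.estimate-bound first) (Summary.estimate-bound second)
      ; positive       = Summary.positive second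
      }
      where
      d₁ = Summary.decrements first
      d₂ = Summary.decrements second
      mass-bound : (d₁ + d₂) * suc w + mass st₂ ≤ (a₁ + a₂) + mass st₀
      mass-bound = begin
        (d₁ + d₂) * suc w + mass st₂
          ≡⟨ cong (_+ mass st₂) (*-distribʳ-+ (suc w) d₁ d₂) ⟩
        (d₁ * suc w + d₂ * suc w) + mass st₂
          ≡⟨ cong (_+ mass st₂) (+-comm (d₁ * suc w) (d₂ * suc w)) ⟩
        (d₂ * suc w + d₁ * suc w) + mass st₂
          ≤⟨ ≤-telescope (d₂ * suc w) (d₁ * suc w) a₂ a₁
               (Summary.mass-bound second) (Summary.mass-bound first) ⟩
        (a₂ + a₁) + mass st₀
          ≡⟨ cong (_+ mass st₀) (+-comm a₂ a₁) ⟩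
        (a₁ + a₂) + mass st₀ ∎
        where open ≤-Reasoning

    increment-summary : ∀ {y st} → stored _≟_ y st ≡ true → Positive st →
                        Summary x w 1 (hit y x) st (increment _≟_ y st)
    increment-summary {y} {st} isStored pos = record
      { decrements     = 0
      ; mass-bound     = mass-increment y st
      ; estimate-bound = estimate-bound
      ; positive       = increment-positive y st pos
      }
      where
      estimate-bound : hit y x + estimate _≟_ x st ≤ estimate _≟_ x (increment _≟_ y st)
      estimate-bound with y ≟ x
      ... | yes refl = ≤-reflexive (sym (estimate-increment-self y st isStored))
      ... | no  y≢x  = ≤-reflexive (sym (estimate-increment-other x y st (≢-sym y≢x)))

    append-summary : ∀ {y st} → stored _≟_ y st ≡ false → Positive st →
                     Summary x w 1 (hit y x) st (st ++ [ (y , 1) ])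
    append-summary {y} {st} unstored pos = record
      { decrements     = 0
      ; mass-bound     = ≤-reflexive (trans (mass-++ st _) (+-comm (mass st) 1))
      ; estimate-bound = estimate-bound
      ; positive       = ++⁺ pos (s≤s z≤n ∷ [])
      }
      where
      estimate-bound : hit y x + estimate _≟_ x st ≤ estimate _≟_ x (st ++ [ (y , 1) ])
      estimate-bound with y ≟ x
      ... | yes refl = ≤-reflexive (trans (cong suc (estimate-unstored y st unstored))
                                          (sym (estimate-append-unstored y st unstored)))
      ... | no  _    = estimate-++ x st _

    decrementAll-summary : ∀ {y st} → stored _≟_ y st ≡ false → w ≤ length st → Positive st →
                           Summary x w 1 (hit y x) st (decrementAll _≟_ st)
    decrementAll-summary {y} {st} unstored w≤length pos = record
      { decrements     = 1
      ; mass-bound     = mass-bound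
      ; estimate-bound = estimate-bound
      ; positive       = decrementAll-positive st
      }
      where
      mass-bound : 1 * suc w + mass (decrementAll _≟_ st) ≤ suc (mass st)
      mass-bound = begin
        1 * suc w + mass (decrementAll _≟_ st)
          ≡⟨ cong (_+ mass (decrementAll _≟_ st)) (*-identityˡ (suc w)) ⟩
        suc w + mass (decrementAll _≟_ st)
          ≤⟨ +-monoˡ-≤ (mass (decrementAll _≟_ st)) (s≤s w≤length) ⟩
        suc (length st + mass (decrementAll _≟_ st))
          ≡⟨ cong suc (length+mass-decrementAll st pos) ⟩
        suc (mass st) ∎
        where open ≤-Reasoning
      estimate-bound : hit y x + estimate _≟_ x st ≤ suc (estimate _≟_ x (decrementAll _≟_ st))
      estimate-bound with y ≟ x
      ... | yes refl = ≤-trans (≤-reflexive (cong suc (estimate-unstored y st unstored))) (s≤s z≤n)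
      ... | no  _    = estimate-decrementAll x st

    insert-summary : ∀ y st → Positive st → Summary x w 1 (hit y x) st (mgInsert _≟_ w y st)
    insert-summary y st pos with stored _≟_ y st in eq
    ... | true = increment-summary eq pos
    ... | false with length st <ᵇ w | <ᵇ-reflects-< (length st) w
    ...   | true  | _            = append-summary eq pos
    ...   | false | ofⁿ length≮w = decrementAll-summary eq (≮⇒≥ length≮w) pos

    processRange-summary : ∀ s from len st → Positive st →
                           Summary x w len (hits s from len x) st (processRange _≟_ w s from len st)
    processRange-summary s from zero      st pos = empty-summary pos
    processRange-summary s from (suc len) st pos =
      first ⨾ processRange-summary s (suc from) len _ (Summary.positive first)
      where first = insert-summary (s from) st pos

module Sublime {K : Set} (_≟_ : DecidableEquality K) (x : K) (W N : ℕ → ℕ) (s : ℕ → K)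
               (N-mono : ∀ j → N j ≤ N (suc j)) (W-mono : ∀ j → W (N j) ≤ W (N (suc j))) where

  open MisraGries _≟_

  sketch : ℕ → MGState K
  sketch = sublimeMG _≟_ W N s

  record Invariant (i : ℕ) : Set where
    field
      decrements      : ℕ
      positive        : Positive (sketch i)
      error-bound     : freq _≟_ s (N i) x ≤ decrements + estimate _≟_ x (sketch i)
      potential-bound : decrements /suc 0 ℚᵘ.+ mass (sketch i) /suc W (N i)
                          ℚᵘ.≤ ℚ.toℚᵘ (errorBound W N i)

  invariant : ∀ i → Invariant i
  invariant zero = record
    { decrements      = decrements
    ; positive        = positive
    ; error-bound     = ≤-trans (≤-reflexive (trans (freq-+ s 0 (N 0) x) (sym (+-identityʳ _))))
                                estimate-bound
    ; potential-bound = ℚᵘ.≤-respʳ-≃ (ℚᵘ.≃-sym (toℚᵘ-/ (N 0) (W (N 0))))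
                          (amortised-≤ decrements (mass (sketch 0)) (W (N 0))
                            (≤-trans mass-bound (≤-reflexive (+-identityʳ (N 0)))))
    }
    where open Summary (processRange-summary {x} s 0 (N 0) [] [])
  invariant (suc i) = record
    { decrements      = D + D′
    ; positive        = Summary.positive epoch
    ; error-bound     = error-bound′
    ; potential-bound = ℚᵘ.≤-respʳ-≃ (ℚᵘ.≃-sym (toℚᵘ-errorBound-suc W N i))
                          (potential-step D D′ (W-mono i) (Summary.mass-bound epoch) potential-bound)
    }
    where
    open Invariant (invariant i) renaming (decrements to D)
    len = N (suc i) ∸ N i
    epoch : Summary x (W (N (suc i))) len (hits s (N i) len x) (sketch i) (sketch (suc i))
    epoch = processRange-summary s (N i) len (sketch i) positive
    D′ = Summary.decrements epoch
    error-bound′ : freq _≟_ s (N (suc i)) x ≤ (D + D′) + estimate _≟_ x (sketch (suc i))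
    error-bound′ = begin
      freq _≟_ s (N (suc i)) x
        ≡⟨ cong (λ n → freq _≟_ s n x) (m+[n∸m]≡n (N-mono i)) ⟨
      freq _≟_ s (N i + len) x
        ≡⟨ freq-+ s (N i) len x ⟩
      freq _≟_ s (N i) x + hits s (N i) len x
        ≡⟨ +-identityʳ _ ⟨
      (freq _≟_ s (N i) x + hits s (N i) len x) + 0
        ≤⟨ ≤-telescope (freq _≟_ s (N i) x) (hits s (N i) len x) D D′
             (≤-trans (≤-reflexive (+-identityʳ _)) error-bound) (Summary.estimate-bound epoch) ⟩
      (D + D′) + estimate _≟_ x (sketch (suc i)) ∎
      where open ≤-Reasoning

-- Monotonicity of W is only needed across epoch boundaries, where the last hypothesis gives it.
lemmaB3 : {K : Set} (_≟_ : DecidableEquality K)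
          (W : ℕ → ℕ) (N : ℕ → ℕ) (s : ℕ → K) →
          (∀ m n → m ≤ n → W m ≤ W n) →
          (∀ j → N j < N (suc j)) →
          (∀ j → W (N j) < W (N (suc j))) →
          ∀ (i : ℕ) (x : K) →
          ((+ freq _≟_ s (N i) x) / 1 - (+ estimate _≟_ x (sublimeMG _≟_ W N s i)) / 1)
            ℚ.≤ errorBound W N i
lemmaB3 _≟_ W N s _ N-increasing W-increasing i x =
  difference-≤ {D = decrements} error-bound
    (ℚᵘ.≤-trans (ℚᵘ.p≤p+q (decrements /suc 0) (mass (sketch i) /suc W (N i))) potential-bound)
  where
  open MisraGries _≟_ using (mass)
  open Sublime _≟_ x W N s (λ j → <⇒≤ (N-increasing j)) (λ j → <⇒≤ (W-increasing j))
  open Invariant (invariant i)
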